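{- Let $t\geq 5$ be an integer, and let $\mathcal{K}$, $(T_K:K\in\mathcal{K})$ and $G_t$ be as described in the context. Let $K\in\mathcal{K}$ and let $H$ be a connected induced subgraph of $T_K$ such that any two vertices of $H$ are at distance at most $t-1$ in $H$. Then $H$ is an induced subgraph of $G_t$.
   Context: Graphs are finite and simple; path length = number of edges; distances are shortest-path lengths. Territories. A territory is a pair $(T,B)$ where $T$ is a graph and $B$ an induced cycle in $T$; its perimeter is the length of $B$. Expansion (w.r.t. $t$): given a territory $(T',B')$, choose for some $k\geq0$ a stable set $\{x_1,\dots,x_k\}$ of $B'$, let $x_i^-,x_i^+$ be the neighbours of $x_i$ in $B'$, and choose $I\subseteq\{1,\dots,k\}$. Build $T$ from $T'$: for each $i$ add a new path $P_i$ of length $2t-6$ with ends $y_i^-,y_i^+$ and middle vertex $y_i$, and edges $x_i^-y_i^-,x_iy_i,x_i^+y_i^+$; for each $i\in I$, with $v_i^-,v_i^+$ the neighbours of $y_i$ in $P_i$ ($v_i^-$ on the side of $y_i^-$), add a new path $Q_i$ of length $t-4$ with ends $z_i^-,z_i^+$ and edges $v_i^-z_i^-,v_i^+z_i^+$ (all new vertices distinct). For $i\notin I$, $R_i=x_i^-\text{ - }y_i^-\text{ - }P_i\text{ - }y_i^+\text{ - }x_i^+$; for $i\in I$, $R_i$ goes $x_i^-,y_i^-$, along $P_i$ to $v_i^-$, $z_i^-$, along $Q_i$ to $z_i^+$, $v_i^+$, along $P_i$ to $y_i^+$, $x_i^+$. Set $B=(B'\setminus\{x_1,\dots,x_k\})\cup\bigcup_iR_i$;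 $(T,B)$ is an expansion of $(T',B')$. The territories $(T_m,B_m)$: $T_0=B_0$ is a $t$-cycle; for $m\ge1$, with $N=t(t-3)^{m-1}$ and $B_{m-1}=x_1\text{ - }\cdots\text{ - }x_N\text{ - }x_1$, $T_m$ is obtained from $T_{m-1}$ by adding a new cycle $B_m$, the $(t-4)$-subdivision of an $N$-cycle $x_1'\text{ - }\cdots\text{ - }x_N'\text{ - }x_1'$ (each edge replaced by a path of length $t-3$), and the edges $x_ix_i'$. A territory $(T,B)$ is canonical if for some $m\ge0$ there is an expansion $(T',B')$ of $(T_m,B_m)$ and an isomorphism $T\to T'$ mapping $B$ isomorphically onto $B'$. Construction. Let $g=t^{5t}$ and let $\Gamma$ be a $3$-regular graph of girth at least $g$ with a Hamiltonian cycle $\Omega$. Let $(M_1,M_2)$ be a partition of $E(\Omega)$ into two perfect matchings of $\Gamma$ and $M_3=E(\Gamma)\setminus E(\Omega)$. For $i\in\{1,2,3\}$ let $\mathcal{K}_i$ be the set of components (cycles) of the spanning subgraph of $\Gamma$ with edge set $E(\Gamma)\setminus M_i$, and $\mathcal{K}=\mathcal{K}_1\cup\mathcal{K}_2\cup\mathcal{K}_3$. For each $K\in\mathcal{K}$ let $T_K$ be a graph such that $(T_K,K)$ is a canonical territory (of perimeter equal to the length of $K$), with $V(T_K)\cap V(\Gamma)=V(K)$, and such that $V(T_K)\cap V(T_{K'})=V(K)\cap V(K')$ for all distinct $K,K'\in\mathcal{K}$. Define $G_t=\Gamma\cup\bigcup_{K\in\mathcal{K}}T_K$ (union of vertex sets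 and of edge sets). -}

module Defs where

open import Data.Nat using (ℕ; zero; suc; _+_; _*_; _∸_; _^_; _≤_)
open import Data.Fin using (Fin; toℕ)
open import Data.Fin.Patterns using (0F; 1F; 2F)
open import Data.Product using (Σ; _×_; _,_; proj₁; proj₂)
open import Data.Sum using (_⊎_; inj₁; inj₂)
open import Data.Empty using (⊥)
open import Data.Unit using (⊤)
open import Relation.Nullary using (¬_)
open import Relation.Binary.PropositionalEquality using (_≡_)

Iff : Set → Set → Set
Iff A B = (A → B) × (B → A)

record Graph (W : Set) : Set₁ where
  field
    V     : W → Set
    E     : W → W → Set
    E-V   : ∀ {u v} → E u v → V u × V v
    E-sym : ∀ {u v} → E u v → E v u
    E-irr : ∀ {u} → E u u → ⊥
open Graph public

-- walks; "distance ≤ k" = there is a walk with ≤ k edges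
data Walk {W : Set} (G : Graph W) : W → W → ℕ → Set where
  here : ∀ {u} → V G u → Walk G u u 0
  step : ∀ {u w v l} → E G u w → Walk G w v l → Walk G u v (suc l)

Connected : {W : Set} → Graph W → Set
Connected {W} G = Σ W (V G) × (∀ u v → V G u → V G v → Σ ℕ (Walk G u v))

DistAtMost : {W : Set} → Graph W → ℕ → Set
DistAtMost G k = ∀ u v → V G u → V G v → Σ ℕ λ l → l ≤ k × Walk G u v l

InducedSubgraph : {W : Set} → Graph W → Graph W → Set
InducedSubgraph {W} H G =
  (∀ w → V H w → V G w) ×
  (∀ u v → V H u → V H v → Iff (E H u v) (E G u v))

-- cyclic successor / adjacency on positions 0..L-1 of a cycle of length L
Succ : ℕ → ℕ → ℕ → Set
Succ L a b = (suc a ≡ b) ⊎ (suc a ≡ L × b ≡ 0)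

CycAdj : ℕ → ℕ → ℕ → Set
CycAdj L a b = Succ L a b ⊎ Succ L b a

IsCycle : {W : Set} → Graph W → (L : ℕ) → (Fin L → W) → Set
IsCycle G L c =
  3 ≤ L ×
  (∀ i j → c i ≡ c j → i ≡ j) ×
  (∀ i → V G (c i)) ×
  (∀ i j → CycAdj L (toℕ i) (toℕ j) → E G (c i) (c j))

GirthAtLeast : {W : Set} → Graph W → ℕ → Set
GirthAtLeast G g = ∀ L c → IsCycle G L c → g ≤ L

ThreeRegular : {W : Set} → Graph W → Set
ThreeRegular {W} G = ∀ v → V G v →
  Σ W λ a → Σ W λ b → Σ W λ c →
    E G v a × E G v b × E G v c ×
    ¬ (a ≡ b) × ¬ (a ≡ c) × ¬ (b ≡ c) ×
    (∀ u → E G v u → (u ≡ a) ⊎ (u ≡ b) ⊎ (u ≡ c))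

deleteEdges : {W : Set} → Graph W → (W → W → Set) → Graph W
deleteEdges G M = record
  { V = V G
  ; E = λ u v → E G u v × ¬ M u v × ¬ M v u
  ; E-V = λ { (e , _) → E-V G e }
  ; E-sym = λ { (e , a , b) → E-sym G e , b , a }
  ; E-irr = λ { (e , _) → E-irr G e }
  }

unionGraph : {W K : Set} → Graph W → (K → Graph W) → Graph W
unionGraph {W} {K} G T = record
  { V = λ w → V G w ⊎ Σ K (λ k → V (T k) w)
  ; E = λ u v → E G u v ⊎ Σ K (λ k → E (T k) u v)
  ; E-V = ev
  ; E-sym = λ { (inj₁ e) → inj₁ (E-sym G e) ; (inj₂ (k , e)) → inj₂ (k , E-sym (T k) e) }
  ; E-irr = λ { (inj₁ e) → E-irr G e ; (inj₂ (k , e)) → E-irr (T k) e }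
  }
  where
  ev : ∀ {u v} → (E G u v ⊎ Σ K (λ k → E (T k) u v)) →
       (V G u ⊎ Σ K (λ k → V (T k) u)) × (V G v ⊎ Σ K (λ k → V (T k) v))
  ev (inj₁ e) = inj₁ (proj₁ (E-V G e)) , inj₁ (proj₂ (E-V G e))
  ev (inj₂ (k , e)) = inj₂ (k , proj₁ (E-V (T k) e)) , inj₂ (k , proj₂ (E-V (T k) e))

record VIso {W : Set} (G : Graph W) (X : Set) (EX : X → X → Set) : Set where
  field
    f   : (w : W) → V G w → X
    g   : X → W
    g-V : ∀ x → V G (g x)
    gf  : ∀ w p → g (f w p) ≡ w
    fg  : ∀ x p → f (g x) p ≡ x
    hom : ∀ u v p q → Iff (E G u v) (EX (f u p) (f v q))

Len : ℕ → ℕ → ℕ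
Len t m = t * (t ∸ 3) ^ m

-- vertices of T_m: (level ℓ ≤ m, position j on B_ℓ)
-- B_ℓ is the cycle 0-1-...-(Len t ℓ - 1)-0 at level ℓ; for ℓ ≥ 1 the
-- original vertex x'_i of the subdivided cycle is position i(t-3), and is
-- joined to position i of B_{ℓ-1}.
TV : ℕ → ℕ → Set
TV t m = Σ (Fin (suc m)) (λ ℓ → Fin (Len t (toℕ ℓ)))

TmAdj : (t m : ℕ) → TV t m → TV t m → Set
TmAdj t m (ℓ , j) (ℓ' , j') =
  (toℕ ℓ ≡ toℕ ℓ' × CycAdj (Len t (toℕ ℓ)) (toℕ j) (toℕ j')) ⊎
  (suc (toℕ ℓ) ≡ toℕ ℓ' × toℕ j' ≡ toℕ j * (t ∸ 3)) ⊎
  (suc (toℕ ℓ') ≡ toℕ ℓ × toℕ j ≡ toℕ j' * (t ∸ 3))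

-- status of a position x of B_m: not chosen / chosen with i ∉ I / chosen with i ∈ I
data Status : Set where
  none plain withQ : Status

IsSel : Status → Set
IsSel none  = ⊥
IsSel plain = ⊤
IsSel withQ = ⊤

IsQ : Status → Set
IsQ none  = ⊥
IsQ plain = ⊥
IsQ withQ = ⊤

Stable : (t m : ℕ) → (Fin (Len t m) → Status) → Set
Stable t m s = ∀ p q → CycAdj (Len t m) (toℕ p) (toℕ q) →
  IsSel (s p) → IsSel (s q) → ⊥

-- P_p has vertices 0..2t-6 (y⁻ = 0, y = t-3, y⁺ = 2t-6, v⁻ = t-4, v⁺ = t-2);
-- Q_p has vertices 0..t-4 (z⁻ = 0, z⁺ = t-4).
PV : (t m : ℕ) → (Fin (Len t m) → Status) → Set
PV t m s = Σ (Fin (Len t m)) (λ p → IsSel (s p)) × Fin (2 * t ∸ 5)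

QV : (t m : ℕ) → (Fin (Len t m) → Status) → Set
QV t m s = Σ (Fin (Len t m)) (λ p → IsQ (s p)) × Fin (t ∸ 3)

XV : (t m : ℕ) → (Fin (Len t m) → Status) → Set
XV t m s = TV t m ⊎ (PV t m s ⊎ QV t m s)

-- edges x⁻y⁻, x y, x⁺y⁺ (x⁻ = predecessor, x⁺ = successor of x on B_m)
TPAdj : (t m : ℕ) (s : Fin (Len t m) → Status) → TV t m → PV t m s → Set
TPAdj t m s (ℓ , j) ((p , _) , k) =
  toℕ ℓ ≡ m ×
  ((Succ (Len t m) (toℕ j) (toℕ p) × toℕ k ≡ 0) ⊎
   (toℕ j ≡ toℕ p × toℕ k ≡ t ∸ 3) ⊎
   (Succ (Len t m) (toℕ p) (toℕ j) × toℕ k ≡ 2 * t ∸ 6))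

PPAdj : (t m : ℕ) (s : Fin (Len t m) → Status) → PV t m s → PV t m s → Set
PPAdj t m s ((p , _) , k) ((p' , _) , k') =
  p ≡ p' × ((suc (toℕ k) ≡ toℕ k') ⊎ (suc (toℕ k') ≡ toℕ k))

PQAdj : (t m : ℕ) (s : Fin (Len t m) → Status) → PV t m s → QV t m s → Set
PQAdj t m s ((p , _) , k) ((q , _) , r) =
  p ≡ q × ((toℕ k ≡ t ∸ 4 × toℕ r ≡ 0) ⊎ (toℕ k ≡ t ∸ 2 × toℕ r ≡ t ∸ 4))

QQAdj : (t m : ℕ) (s : Fin (Len t m) → Status) → QV t m s → QV t m s → Set
QQAdj t m s ((p , _) , k) ((p' , _) , k') =
  p ≡ p' × ((suc (toℕ k) ≡ toℕ k') ⊎ (suc (toℕ k') ≡ toℕ k))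

XE : (t m : ℕ) (s : Fin (Len t m) → Status) → XV t m s → XV t m s → Set
XE t m s (inj₁ a) (inj₁ b) = TmAdj t m a b
XE t m s (inj₁ a) (inj₂ (inj₁ x)) = TPAdj t m s a x
XE t m s (inj₁ a) (inj₂ (inj₂ z)) = ⊥
XE t m s (inj₂ (inj₁ x)) (inj₁ a) = TPAdj t m s a x
XE t m s (inj₂ (inj₁ x)) (inj₂ (inj₁ y)) = PPAdj t m s x y
XE t m s (inj₂ (inj₁ x)) (inj₂ (inj₂ z)) = PQAdj t m s x z
XE t m s (inj₂ (inj₂ z)) (inj₁ a) = ⊥
XE t m s (inj₂ (inj₂ z)) (inj₂ (inj₁ x)) = PQAdj t m s x z
XE t m s (inj₂ (inj₂ z)) (inj₂ (inj₂ z')) = QQAdj t m s z z'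

InBP : ℕ → Status → ℕ → Set
InBP t none  k = ⊥
InBP t plain k = ⊤
InBP t withQ k = ¬ (k ≡ t ∸ 3)

InB : (t m : ℕ) (s : Fin (Len t m) → Status) → XV t m s → Set
InB t m s (inj₁ (ℓ , j)) =
  toℕ ℓ ≡ m × Σ (Fin (Len t m)) (λ p → toℕ p ≡ toℕ j × s p ≡ none)
InB t m s (inj₂ (inj₁ ((p , _) , k))) = InBP t (s p) (toℕ k)
InB t m s (inj₂ (inj₂ _)) = ⊤

-- (T , B) is a canonical territory (B given by its vertex set)
Canonical : {W : Set} → ℕ → Graph W → (W → Set) → Set
Canonical t T B =
  Σ ℕ λ m → Σ (Fin (Len t m) → Status) λ s → Stable t m s ×
  Σ (VIso T (XV t m s) (XE t m s)) λ φ →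
    ∀ w p → Iff (B w) (InB t m s (VIso.f φ w p))

Mfam : {W : Set} → (M₃ M₁ M₂ : W → W → Set) → Fin 3 → W → W → Set
Mfam M₃ M₁ M₂ 0F = M₁
Mfam M₃ M₁ M₂ 1F = M₂
Mfam M₃ M₁ M₂ 2F = M₃

record GtData (t : ℕ) (W : Set) : Set₁ where
  field
    Γ      : Graph W
    Γ-reg  : ThreeRegular Γ
    Γ-girth : GirthAtLeast Γ (t ^ (5 * t))
    n      : ℕ
    ω      : Fin n → W
    Ω-cyc  : IsCycle Γ n ω
    Ω-span : ∀ w → V Γ w → Σ (Fin n) λ i → ω i ≡ w
  EΩ : W → W → Set
  EΩ u v = Σ (Fin n) λ i → Σ (Fin n) λ j → u ≡ ω i × v ≡ ω j × CycAdj n (toℕ i) (toℕ j)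
  field
    M₁ M₂ : W → W → Set
    M₁-sym : ∀ {u v} → M₁ u v → M₁ v u
    M₂-sym : ∀ {u v} → M₂ u v → M₂ v u
    M₁-Ω : ∀ {u v} → M₁ u v → EΩ u v
    M₂-Ω : ∀ {u v} → M₂ u v → EΩ u v
    Ω-M  : ∀ {u v} → EΩ u v → M₁ u v ⊎ M₂ u v
    M-disj : ∀ {u v} → M₁ u v → M₂ u v → ⊥
    M₁-perfect : ∀ v → V Γ v → Σ W (M₁ v) × (∀ u u' → M₁ v u → M₁ v u' → u ≡ u')
    M₂-perfect : ∀ v → V Γ v → Σ W (M₂ v) × (∀ u u' → M₂ v u → M₂ v u' → u ≡ u')
  -- M 0F = M₁, M 1F = M₂, M 2F = M₃ = E(Γ) ∖ E(Ω)
  M : Fin 3 → W → W → Set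
  M = Mfam (λ u v → E Γ u v × ¬ EΩ u v) M₁ M₂
  ΓM : Fin 3 → Graph W
  ΓM i = deleteEdges Γ (M i)
  field
    -- 𝒦 = 𝒦₁ ∪ 𝒦₂ ∪ 𝒦₃ : the element K lies in 𝒦_(κ K), with vertex set VK K
    𝒦  : Set
    κ  : 𝒦 → Fin 3
    VK : 𝒦 → W → Set
    VK-ne     : ∀ K → Σ W (VK K)
    VK-Γ      : ∀ K w → VK K w → V Γ w
    VK-closed : ∀ K u v → VK K u → E (ΓM (κ K)) u v → VK K v
    VK-conn   : ∀ K u v → VK K u → VK K v → Σ ℕ (Walk (ΓM (κ K)) u v)
    𝒦-cover   : ∀ i w → V Γ w → Σ 𝒦 λ K → κ K ≡ i × VK K w
    𝒦-unique  : ∀ K K' w → κ K ≡ κ K' → VK K w → VK K' w → K ≡ K'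
  EK : 𝒦 → W → W → Set
  EK K u v = VK K u × VK K v × E (ΓM (κ K)) u v
  field
    T : 𝒦 → Graph W
    T-K      : ∀ K w → VK K w → V (T K) w
    T-induced : ∀ K u v → VK K u → VK K v → Iff (E (T K) u v) (EK K u v)
    T-canon  : ∀ K → Canonical t (T K) (VK K)
    T-Γ      : ∀ K w → Iff (V (T K) w × V Γ w) (VK K w)
    T-disj   : ∀ K K' → ¬ (K ≡ K') → ∀ w →
                 Iff (V (T K) w × V (T K') w) (VK K w × VK K' w)
  Gt : Graph W
  Gt = unionGraph Γ T

{-# OPTIONS --safe #-}
module Submission where

open import Data.Nat
  using (ℕ; zero; suc; pred; _+_; _*_; _∸_; _^_; _≤_; _<_; z≤n; s≤s; _≟_; _≤?_; NonZero; >-nonZero)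
open import Data.Nat.Properties
open import Data.Nat.Tactic.RingSolver using (solve-∀)
open import Data.Fin as Fin using (Fin; toℕ; fromℕ; fromℕ<; cast)
open import Data.Fin.Properties using (toℕ-fromℕ; toℕ-fromℕ<; toℕ-cast; toℕ-injective; fromℕ<-toℕ; toℕ<n)
open import Data.Product using (Σ; ∃-syntax; _×_; _,_; proj₁; proj₂)
import Data.Product.Properties as Productₚ
open import Data.Sum using (_⊎_; inj₁; inj₂; swap)
import Data.Sum.Properties as Sumₚ
open import Data.Empty using (⊥; ⊥-elim)
open import Data.Unit using (tt)
open import Function using (_∘_)
open import Function.Definitions using (Injective)
open import Relation.Nullary using (¬_; yes; no; Dec)
open import Relation.Nullary.Decidable using (_×-dec_; _⊎-dec_)
open import Relation.Binary.Definitions using (DecidableEquality; Symmetric)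
open import Relation.Binary.PropositionalEquality

open import Defs

-- Edges of H lie in T_K ⊆ G_t, so the point is that vertices u, v of H adjacent in G_t are
-- adjacent in T_K.  An edge of another T_K' between vertices of T_K joins two vertices of K ∩ K'
-- and lies on the induced cycle K', hence in Γ; so let uv be an edge of Γ with u, v on K.
-- In the canonical territory T_K (an expansion of (T_m, B_m)) a walk of length l ≤ t - 1 from
-- u to v projects to positions of B_m at most l (t-3)^l apart: a step at depth d below B_m moves
-- the projection by at most (t-3)^d and deepens by at most one.  Every vertex of K is within 3t
-- steps along K of a fixed vertex of K above its position, so u and v are joined along K by a
-- walk of length less than t^(5t) - 1.  Together with uv this would close a cycle of Γ shorter
-- than its girth unless, after loop erasure, the walk is the single edge uv; so uv is an edge of K.

data Chain {A : Set} (R : A → A → Set) : A → A → ℕ → Set where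
  ε   : ∀ {a} → Chain R a a 0
  _◅_ : ∀ {a b c l} → R a b → Chain R b c l → Chain R a c (suc l)

infixr 5 _◅_

Within : {A : Set} → (A → A → Set) → ℕ → A → A → Set
Within R n a b = ∃[ l ] l ≤ n × Chain R a b l

module _ {A : Set} {R : A → A → Set} where

  infixr 5 _◅◅_

  _◅◅_ : ∀ {a b c l l'} → Chain R a b l → Chain R b c l' → Chain R a c (l + l')
  ε ◅◅ w = w
  (r ◅ v) ◅◅ w = r ◅ (v ◅◅ w)

  _∷ʳ_ : ∀ {a b c l} → Chain R a b l → R b c → Chain R a c (suc l)
  ε ∷ʳ r = r ◅ ε
  (r' ◅ w) ∷ʳ r = r' ◅ (w ∷ʳ r)

  reverse : Symmetric R → ∀ {a b l} → Chain R a b l → Chain R b a l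
  reverse R-sym ε = ε
  reverse R-sym (r ◅ w) = reverse R-sym w ∷ʳ R-sym r

  within-refl : ∀ {a n} → Within R n a a
  within-refl = 0 , z≤n , ε

  within-step : ∀ {a b} → R a b → Within R 1 a b
  within-step r = 1 , s≤s z≤n , r ◅ ε

  within-trans : ∀ {a b c n n'} → Within R n a b → Within R n' b c → Within R (n + n') a c
  within-trans (l , l≤n , v) (l' , l'≤n' , w) = l + l' , +-mono-≤ l≤n l'≤n' , v ◅◅ w

  within-mono : ∀ {a b n n'} → n ≤ n' → Within R n a b → Within R n' a b
  within-mono n≤n' (l , l≤n , w) = l , ≤-trans l≤n n≤n' , w

  within-sym : Symmetric R → ∀ {a b n} → Within R n a b → Within R n b a
  within-sym R-sym (l , l≤n , w) = l , l≤n , reverse R-sym w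

index-chain : ∀ {A : Set} {R : A → A → Set} {n} (v : (k : ℕ) → .(k < n) → A) →
  ∀ d k .(hk : k < n) k' .(hk' : k' < n) → k + d ≡ k' →
  (∀ i .(hi : i < n) .(hi' : suc i < n) → k ≤ i → suc i ≤ k' → R (v i hi) (v (suc i) hi')) →
  Chain R (v k hk) (v k' hk') d
index-chain v zero k hk k' hk' k+0≡k' _ rewrite +-identityʳ k | k+0≡k' = ε
index-chain v (suc d) k hk k' hk' k+d+1≡k' edge =
  edge k hk (≤-<-trans k+1≤k' hk') ≤-refl k+1≤k' ◅
  index-chain v d (suc k) (≤-<-trans k+1≤k' hk') k' hk' k+1+d≡k'
    (λ i hi hi' k+1≤i → edge i hi hi' (≤-trans (n≤1+n k) k+1≤i))
  where
  k+1+d≡k' : suc k + d ≡ k'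
  k+1+d≡k' = trans (sym (+-suc k d)) k+d+1≡k'
  k+1≤k' : suc k ≤ k'
  k+1≤k' = subst (suc k ≤_) k+1+d≡k' (m≤m+n (suc k) d)

-- Loop erasure

module LoopErasure {A : Set} (R : A → A → Set) (_≟_ : DecidableEquality A) where

  mutual
    data SimpleChain : A → A → ℕ → Set where
      ε   : ∀ {a} → SimpleChain a a 0
      cons : ∀ {a b c l} → R a b → (p : SimpleChain b c l) → ¬ (a ∈ p) → SimpleChain a c (suc l)

    _∈_ : ∀ {b c l} → A → SimpleChain b c l → Set
    _∈_ x (ε {a}) = x ≡ a
    _∈_ x (cons {a = a} _ p _) = x ≡ a ⊎ x ∈ p

  _∈?_ : ∀ {b c l} x (p : SimpleChain b c l) → Dec (x ∈ p)
  x ∈? ε = x ≟ _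
  x ∈? cons {a = a} r p a∉p with x ≟ a | x ∈? p
  ... | yes x≡a | _       = yes (inj₁ x≡a)
  ... | no _    | yes x∈p = yes (inj₂ x∈p)
  ... | no x≢a  | no x∉p  = no λ { (inj₁ x≡a) → x≢a x≡a ; (inj₂ x∈p) → x∉p x∈p }

  suffix : ∀ {b c l} x (p : SimpleChain b c l) → x ∈ p → ∃[ l' ] l' ≤ l × SimpleChain x c l'
  suffix x ε refl = 0 , z≤n , ε
  suffix x (cons {l = l} r p a∉p) (inj₁ refl) = suc l , ≤-refl , cons r p a∉p
  suffix x (cons r p _) (inj₂ x∈p) with suffix x p x∈p
  ... | l' , l'≤l , q = l' , m≤n⇒m≤1+n l'≤l , q

  erase : ∀ {a c l} → Chain R a c l → ∃[ l' ] l' ≤ l × SimpleChain a c l'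
  erase ε = 0 , z≤n , ε
  erase {a} (r ◅ w) with erase w
  ... | l' , l'≤l , p with a ∈? p
  ... | yes a∈p = let l'' , l''≤l' , q = suffix a p a∈p in l'' , m≤n⇒m≤1+n (≤-trans l''≤l' l'≤l) , q
  ... | no a∉p  = suc l' , s≤s l'≤l , cons r p a∉p

  vertex : ∀ {a c l} → SimpleChain a c l → Fin (suc l) → A
  vertex (ε {a}) Fin.zero = a
  vertex (cons {a = a} _ _ _) Fin.zero = a
  vertex (cons _ p _) (Fin.suc i) = vertex p i

  vertex-zero : ∀ {a c l} (p : SimpleChain a c l) → vertex p Fin.zero ≡ a
  vertex-zero ε = refl
  vertex-zero (cons _ _ _) = refl

  vertex-last : ∀ {a c l} (p : SimpleChain a c l) (i : Fin (suc l)) → toℕ i ≡ l → vertex p i ≡ c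
  vertex-last ε Fin.zero _ = refl
  vertex-last (cons _ p _) (Fin.suc i) i≡l = vertex-last p i (suc-injective i≡l)

  vertex-∈ : ∀ {a c l} (p : SimpleChain a c l) i → vertex p i ∈ p
  vertex-∈ ε Fin.zero = refl
  vertex-∈ (cons _ _ _) Fin.zero = inj₁ refl
  vertex-∈ (cons _ p _) (Fin.suc i) = inj₂ (vertex-∈ p i)

  vertex-injective : ∀ {a c l} (p : SimpleChain a c l) → Injective _≡_ _≡_ (vertex p)
  vertex-injective ε {Fin.zero} {Fin.zero} _ = refl
  vertex-injective (cons _ _ _) {Fin.zero} {Fin.zero} _ = refl
  vertex-injective (cons _ p a∉p) {Fin.zero} {Fin.suc j} e =
    ⊥-elim (a∉p (subst (_∈ p) (sym e) (vertex-∈ p j)))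
  vertex-injective (cons _ p a∉p) {Fin.suc i} {Fin.zero} e =
    ⊥-elim (a∉p (subst (_∈ p) e (vertex-∈ p i)))
  vertex-injective (cons _ p _) {Fin.suc i} {Fin.suc j} e = cong Fin.suc (vertex-injective p e)

  vertex-step : ∀ {a c l} (p : SimpleChain a c l) (i j : Fin (suc l)) →
    suc (toℕ i) ≡ toℕ j → R (vertex p i) (vertex p j)
  vertex-step (cons r p _) Fin.zero (Fin.suc Fin.zero) _ = subst (R _) (sym (vertex-zero p)) r
  vertex-step (cons _ p _) (Fin.suc i) (Fin.suc j) e = vertex-step p i j (suc-injective e)

  module _ {W : Set} (G : Graph W) (φ : A → W) (φ-injective : Injective _≡_ _≡_ φ)
           (φ-edge : ∀ {x y} → R x y → E G (φ x) (φ y)) where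

    closed-isCycle : ∀ {a c l} (p : SimpleChain a c l) → 2 ≤ l → E G (φ c) (φ a) →
      IsCycle G (suc l) (φ ∘ vertex p)
    closed-isCycle {a} {c} {l} p 2≤l ca =
      s≤s 2≤l , (λ i j → vertex-injective p ∘ φ-injective) , on-G p (proj₂ (E-V G ca)) , adjacent
      where
      on-G : ∀ {a' c' l'} (p : SimpleChain a' c' l') → V G (φ a') → ∀ i → V G (φ (vertex p i))
      on-G ε a∈G Fin.zero = a∈G
      on-G (cons _ _ _) a∈G Fin.zero = a∈G
      on-G (cons r p _) _ (Fin.suc i) = on-G p (proj₂ (E-V G (φ-edge r))) i
      forward : ∀ i j → Succ (suc l) (toℕ i) (toℕ j) → E G (φ (vertex p i)) (φ (vertex p j))
      forward i j (inj₁ i+1≡j) = φ-edge (vertex-step p i j i+1≡j)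
      forward i j (inj₂ (i+1≡l+1 , j≡0)) =
        subst₂ (λ x y → E G (φ x) (φ y))
          (sym (vertex-last p i (suc-injective i+1≡l+1)))
          (trans (sym (vertex-zero p)) (cong (vertex p) (sym (toℕ-injective {i = j} {j = Fin.zero} j≡0))))
          ca
      adjacent : ∀ i j → CycAdj (suc l) (toℕ i) (toℕ j) → E G (φ (vertex p i)) (φ (vertex p j))
      adjacent i j (inj₁ s) = forward i j s
      adjacent i j (inj₂ s) = E-sym G (forward j i s)

    -- After loop erasure, a path of length ≥ 2 plus the closing edge is a cycle shorter than g.
    short-detour⇒step : ∀ {g n a c} → GirthAtLeast G g → suc (suc n) ≤ g →
      E G (φ a) (φ c) → Within R n a c → R a c
    short-detour⇒step {g} {n} girth n+2≤g ac (l , l≤n , w) =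
      let k , k≤l , p = erase w in closing p (≤-trans k≤l l≤n) ac
      where
      closing : ∀ {a c k} → SimpleChain a c k → k ≤ n → E G (φ a) (φ c) → R a c
      closing ε _ aa = ⊥-elim (E-irr G aa)
      closing (cons r ε _) _ _ = r
      closing {k = k} p@(cons _ (cons _ _ _) _) k≤n ac =
        let g≤k+1 = girth (suc k) _ (closed-isCycle p (s≤s (s≤s z≤n)) (E-sym G ac))
        in ⊥-elim (1+n≰n (≤-trans n+2≤g (≤-trans g≤k+1 (s≤s k≤n))))

CycleStep : ℕ → ℕ → ℕ → Set
CycleStep N p q = p < N × q < N × CycAdj N p q

CycAdj-sym : ∀ {L} → Symmetric (CycAdj L)
CycAdj-sym = swap

CycleStep-sym : ∀ {N} → Symmetric (CycleStep N)
CycleStep-sym (p<N , q<N , pq) = q<N , p<N , CycAdj-sym pq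

forward-chain : ∀ {N} k p q → p + k ≡ q → q < N → Chain (CycleStep N) p q k
forward-chain zero p q p+0≡q q<N rewrite +-identityʳ p | p+0≡q = ε
forward-chain {N} (suc k) p q p+k+1≡q q<N =
  (≤-<-trans (n≤1+n p) p+1<N , p+1<N , inj₁ (inj₁ refl)) ◅ forward-chain k (suc p) q p+1+k≡q q<N
  where
  p+1+k≡q : suc p + k ≡ q
  p+1+k≡q = trans (sym (+-suc p k)) p+k+1≡q
  p+1<N : suc p < N
  p+1<N = ≤-<-trans (subst (suc p ≤_) p+1+k≡q (m≤m+n (suc p) k)) q<N

scaled-Succ-within : ∀ {N} L C J J' → L * suc C ≡ N → Succ L J J' → J' < L →
  Within (CycleStep N) (suc C) (J * suc C) (J' * suc C)
scaled-Succ-within L C J J' LC≡N (inj₁ refl) J'<L =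
  suc C , ≤-refl , forward-chain (suc C) (J * suc C) (J' * suc C) (+-comm (J * suc C) (suc C))
                     (subst (J' * suc C <_) LC≡N (*-monoˡ-< (suc C) J'<L))
scaled-Succ-within {N} L C J _ LC≡N (inj₂ (J+1≡L , refl)) _ =
  suc C , ≤-refl ,
  forward-chain C (J * suc C) last (+-comm (J * suc C) C) last<N ∷ʳ (last<N , 0<N , inj₁ (inj₂ (last+1≡N , refl)))
  where
  last = C + J * suc C
  last+1≡N : suc last ≡ N
  last+1≡N = trans (cong (_* suc C) J+1≡L) LC≡N
  last<N : last < N
  last<N = ≤-reflexive last+1≡N
  0<N : 0 < N
  0<N = subst (0 <_) last+1≡N (s≤s z≤n)

scaled-CycAdj-within : ∀ {N} L C J J' → L * suc C ≡ N → CycAdj L J J' → J < L → J' < L →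
  Within (CycleStep N) (suc C) (J * suc C) (J' * suc C)
scaled-CycAdj-within L C J J' LC≡N (inj₁ s) _ J'<L = scaled-Succ-within L C J J' LC≡N s J'<L
scaled-CycAdj-within L C J J' LC≡N (inj₂ s) J<L _ =
  within-sym CycleStep-sym (scaled-Succ-within L C J' J LC≡N s J<L)

subgraph-walk : ∀ {W} {H G : Graph W} → InducedSubgraph H G → ∀ {u v l} → Walk H u v l → Walk G u v l
subgraph-walk (H⊆G , _) (here u∈H) = here (H⊆G _ u∈H)
subgraph-walk {H = H} H⊆G@(_ , induced) (step uw w) =
  step (proj₁ (induced _ _ (proj₁ (E-V H uw)) (proj₂ (E-V H uw))) uw) (subgraph-walk H⊆G w)

module VIsoProperties {W X : Set} {EX : X → X → Set} {T : Graph W} (φ : VIso T X EX) where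
  open VIso φ

  f-unique : ∀ w (p : V T w) x → w ≡ g x → f w p ≡ x
  f-unique .(g x) p x refl = fg x p

  f-irrelevant : ∀ w p p' → f w p ≡ f w p'
  f-irrelevant w p p' = f-unique w p (f w p') (sym (gf w p'))

  g-injective : Injective _≡_ _≡_ g
  g-injective {x} {y} gx≡gy = trans (sym (fg x (g-V x))) (f-unique (g x) (g-V x) y gx≡gy)

  walk⇒chain : ∀ {u v l} → Walk T u v l → (pu : V T u) (pv : V T v) → Chain EX (f u pu) (f v pv) l
  walk⇒chain {u} (here _) pu pv = subst (λ y → Chain EX (f u pu) y 0) (f-irrelevant u pu pv) ε
  walk⇒chain (step {u} {w} uw rest) pu pv = proj₁ (hom u w pu pw) uw ◅ walk⇒chain rest pw pv
    where pw = proj₂ (E-V T uw)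

-- The geometry of an expanded territory

IsSel-irrelevant : ∀ {σ} (x y : IsSel σ) → x ≡ y
IsSel-irrelevant {plain} tt tt = refl
IsSel-irrelevant {withQ} tt tt = refl

IsQ-irrelevant : ∀ {σ} (x y : IsQ σ) → x ≡ y
IsQ-irrelevant {withQ} tt tt = refl

IsQ⇒IsSel : ∀ {σ} → IsQ σ → IsSel σ
IsQ⇒IsSel {withQ} tt = tt

Succ? : ∀ L i j → Dec (Succ L i j)
Succ? L i j = (suc i ≟ j) ⊎-dec ((suc i ≟ L) ×-dec (j ≟ 0))

CycAdj? : ∀ L i j → Dec (CycAdj L i j)
CycAdj? L i j = Succ? L i j ⊎-dec Succ? L j i

module Expansion (a m : ℕ) (s : Fin (Len (5 + a) m) → Status) (stable : Stable (5 + a) m s) where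

  t c N : ℕ
  t = 5 + a
  c = t ∸ 3
  N = Len t m

  X : Set
  X = XV t m s

  Ex : X → X → Set
  Ex = XE t m s

  Bx : X → Set
  Bx = InB t m s

  BoundaryEdge : X → X → Set
  BoundaryEdge x y = Bx x × Bx y × Ex x y

  Near : ℕ → ℕ → ℕ → Set
  Near = Within (CycleStep N)

  Ex-sym : ∀ {x y} → Ex x y → Ex y x
  Ex-sym {inj₁ (ℓ , j)} {inj₁ (ℓ' , j')} (inj₁ (ℓ≡ℓ' , jj')) =
    inj₁ (sym ℓ≡ℓ' , subst (λ l → CycAdj (Len t l) (toℕ j') (toℕ j)) ℓ≡ℓ' (CycAdj-sym jj'))
  Ex-sym {inj₁ _} {inj₁ _} (inj₂ (inj₁ up)) = inj₂ (inj₂ up)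
  Ex-sym {inj₁ _} {inj₁ _} (inj₂ (inj₂ down)) = inj₂ (inj₁ down)
  Ex-sym {inj₁ _} {inj₂ (inj₁ _)} e = e
  Ex-sym {inj₂ (inj₁ _)} {inj₁ _} e = e
  Ex-sym {inj₂ (inj₁ _)} {inj₂ (inj₁ _)} (p≡p' , e) = sym p≡p' , swap e
  Ex-sym {inj₂ (inj₁ _)} {inj₂ (inj₂ _)} e = e
  Ex-sym {inj₂ (inj₂ _)} {inj₂ (inj₁ _)} e = e
  Ex-sym {inj₂ (inj₂ _)} {inj₂ (inj₂ _)} (p≡p' , e) = sym p≡p' , swap e

  BoundaryEdge-sym : ∀ {x y} → BoundaryEdge x y → BoundaryEdge y x
  BoundaryEdge-sym (bx , by , e) = by , bx , Ex-sym e

  _≟X_ : DecidableEquality X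
  _≟X_ = Sumₚ.≡-dec (Productₚ.≡-dec Fin._≟_ Fin._≟_)
           (Sumₚ.≡-dec (Productₚ.≡-dec (Productₚ.≡-dec Fin._≟_ sel?) Fin._≟_)
                       (Productₚ.≡-dec (Productₚ.≡-dec Fin._≟_ q?) Fin._≟_))
    where
    sel? : ∀ {σ} → DecidableEquality (IsSel σ)
    sel? x y = yes (IsSel-irrelevant x y)
    q? : ∀ {σ} → DecidableEquality (IsQ σ)
    q? x y = yes (IsQ-irrelevant x y)

  private
    TPAdj? : ∀ x y → Dec (TPAdj t m s x y)
    TPAdj? (ℓ , j) ((p , _) , k) = (toℕ ℓ ≟ m) ×-dec
      ((Succ? N (toℕ j) (toℕ p) ×-dec (toℕ k ≟ 0)) ⊎-dec
       ((toℕ j ≟ toℕ p) ×-dec (toℕ k ≟ t ∸ 3)) ⊎-dec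
       (Succ? N (toℕ p) (toℕ j) ×-dec (toℕ k ≟ 2 * t ∸ 6)))

    PQAdj? : ∀ x y → Dec (PQAdj t m s x y)
    PQAdj? ((p , _) , k) ((q , _) , r) = (p Fin.≟ q) ×-dec
      (((toℕ k ≟ t ∸ 4) ×-dec (toℕ r ≟ 0)) ⊎-dec ((toℕ k ≟ t ∸ 2) ×-dec (toℕ r ≟ t ∸ 4)))

  Ex? : ∀ x y → Dec (Ex x y)
  Ex? (inj₁ (ℓ , j)) (inj₁ (ℓ' , j')) =
    ((toℕ ℓ ≟ toℕ ℓ') ×-dec CycAdj? (Len t (toℕ ℓ)) (toℕ j) (toℕ j')) ⊎-dec
    ((suc (toℕ ℓ) ≟ toℕ ℓ') ×-dec (toℕ j' ≟ toℕ j * (t ∸ 3))) ⊎-dec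
    ((suc (toℕ ℓ') ≟ toℕ ℓ) ×-dec (toℕ j ≟ toℕ j' * (t ∸ 3)))
  Ex? (inj₁ x) (inj₂ (inj₁ y)) = TPAdj? x y
  Ex? (inj₁ x) (inj₂ (inj₂ y)) = no λ ()
  Ex? (inj₂ (inj₁ x)) (inj₁ y) = TPAdj? y x
  Ex? (inj₂ (inj₁ ((p , _) , k))) (inj₂ (inj₁ ((p' , _) , k'))) =
    (p Fin.≟ p') ×-dec ((suc (toℕ k) ≟ toℕ k') ⊎-dec (suc (toℕ k') ≟ toℕ k))
  Ex? (inj₂ (inj₁ x)) (inj₂ (inj₂ y)) = PQAdj? x y
  Ex? (inj₂ (inj₂ x)) (inj₁ y) = no λ ()
  Ex? (inj₂ (inj₂ x)) (inj₂ (inj₁ y)) = PQAdj? y x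
  Ex? (inj₂ (inj₂ ((p , _) , k))) (inj₂ (inj₂ ((p' , _) , k'))) =
    (p Fin.≟ p') ×-dec ((suc (toℕ k) ≟ toℕ k') ⊎-dec (suc (toℕ k') ≟ toℕ k))

  -- With t = 5 + a the vertices of P_p are indexed 0 … top (y⁻ = 0, v⁻ = a + 1, y = a + 2,
  -- v⁺ = a + 3, y⁺ = top) and those of Q_p by 0 … a + 1.  When p ∈ I the boundary avoids y by
  -- the detour through Q_p; every boundary vertex over p is within ρ boundary steps of y⁻, and
  -- Bd = 3t bounds all boundary hops between anchors.
  Psize top ρ Bd : ℕ
  Psize = 2 * t ∸ 5
  top = 4 + (a + a)
  ρ = suc a + (1 + suc a) + (1 + suc a)
  Bd = 3 * t

  Psize≡1+top : Psize ≡ suc top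
  Psize≡1+top = lemma a
    where
    lemma : ∀ a → a + suc (suc (suc (suc (suc (a + 0))))) ≡ 5 + (a + a)
    lemma = solve-∀

  top<Psize : top < Psize
  top<Psize = ≤-reflexive (sym Psize≡1+top)

  0<Psize : 0 < Psize
  0<Psize = ≤-trans (s≤s z≤n) top<Psize

  below-top : ∀ {k} → k < Psize → k ≤ top
  below-top k<Psize = ≤-pred (≤-trans k<Psize (≤-reflexive Psize≡1+top))

  x-vertex : Fin N → X
  x-vertex p = inj₁ (fromℕ m , cast (cong (Len t) (sym (toℕ-fromℕ m))) p)

  P-vertex : (p : Fin N) → IsSel (s p) → (k : ℕ) → .(k < Psize) → X
  P-vertex p sel k k<Psize = inj₂ (inj₁ ((p , sel) , fromℕ< k<Psize))

  Q-vertex : (p : Fin N) → IsQ (s p) → (r : ℕ) → .(r < c) → X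
  Q-vertex p q r r<c = inj₂ (inj₂ ((p , q) , fromℕ< r<c))

  y⁻ y⁺ : (p : Fin N) → IsSel (s p) → X
  y⁻ p sel = P-vertex p sel 0 0<Psize
  y⁺ p sel = P-vertex p sel top top<Psize

  private
    toℕ-x-vertex : ∀ p → toℕ (cast (cong (Len t) (sym (toℕ-fromℕ m))) p) ≡ toℕ p
    toℕ-x-vertex = toℕ-cast (cong (Len t) (sym (toℕ-fromℕ m)))

  x-x-edge : ∀ p q → CycAdj N (toℕ p) (toℕ q) → Ex (x-vertex p) (x-vertex q)
  x-x-edge p q pq = inj₁ (refl ,
    subst₂ (CycAdj (Len t (toℕ (fromℕ m)))) (sym (toℕ-x-vertex p)) (sym (toℕ-x-vertex q))
      (subst (λ L → CycAdj L (toℕ p) (toℕ q)) (cong (Len t) (sym (toℕ-fromℕ m))) pq))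

  x⁻-y⁻-edge : ∀ q p sel → Succ N (toℕ q) (toℕ p) → Ex (x-vertex q) (y⁻ p sel)
  x⁻-y⁻-edge q p sel qp = toℕ-fromℕ m ,
    inj₁ (subst (λ j → Succ N j (toℕ p)) (sym (toℕ-x-vertex q)) qp , toℕ-fromℕ< 0<Psize)

  y⁺-x⁺-edge : ∀ p sel q → Succ N (toℕ p) (toℕ q) → Ex (y⁺ p sel) (x-vertex q)
  y⁺-x⁺-edge p sel q pq = toℕ-fromℕ m ,
    inj₂ (inj₂ (subst (Succ N (toℕ p)) (sym (toℕ-x-vertex q)) pq ,
                trans (toℕ-fromℕ< top<Psize) (sym (cong (_∸ 1) Psize≡1+top))))

  P-edge : ∀ p sel k .h .h' → Ex (P-vertex p sel k h) (P-vertex p sel (suc k) h')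
  P-edge p sel k h h' = refl , inj₁ (trans (cong suc (toℕ-fromℕ< h)) (sym (toℕ-fromℕ< h')))

  Q-edge : ∀ p q r .h .h' → Ex (Q-vertex p q r h) (Q-vertex p q (suc r) h')
  Q-edge p q r h h' = refl , inj₁ (trans (cong suc (toℕ-fromℕ< h)) (sym (toℕ-fromℕ< h')))

  v⁻-z⁻-edge : ∀ p sel q .h .h' → Ex (P-vertex p sel (suc a) h) (Q-vertex p q 0 h')
  v⁻-z⁻-edge p sel q h h' = refl , inj₁ (toℕ-fromℕ< h , toℕ-fromℕ< h')

  z⁺-v⁺-edge : ∀ p sel q .h .h' → Ex (Q-vertex p q (suc a) h') (P-vertex p sel (3 + a) h)
  z⁺-v⁺-edge p sel q h h' = refl , inj₂ (toℕ-fromℕ< h , toℕ-fromℕ< h')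

  x-vertex∈B : ∀ p → s p ≡ none → Bx (x-vertex p)
  x-vertex∈B p unselected = toℕ-fromℕ m , p , sym (toℕ-x-vertex p) , unselected

  P-vertex∈B-plain : ∀ p → s p ≡ plain → ∀ sel k .h → Bx (P-vertex p sel k h)
  P-vertex∈B-plain p e sel k h = subst (λ σ → InBP t σ (toℕ (fromℕ< h))) (sym e) tt

  P-vertex∈B : ∀ p sel k .h → k ≢ suc (suc a) → Bx (P-vertex p sel k h)
  P-vertex∈B p sel k h k≢y = go (s p) refl sel
    where
    go : ∀ σ → s p ≡ σ → IsSel σ → Bx (P-vertex p sel k h)
    go plain e _ = P-vertex∈B-plain p e sel k h
    go withQ e _ =
      subst (λ σ → InBP t σ (toℕ (fromℕ< h))) (sym e) (λ k≡y → k≢y (trans (sym (toℕ-fromℕ< h)) k≡y))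

  along-P : ∀ p sel d k .(hk : k < Psize) k' .(hk' : k' < Psize) → k + d ≡ k' →
    (∀ i .(hi : i < Psize) → k ≤ i → i ≤ k' → Bx (P-vertex p sel i hi)) →
    Chain BoundaryEdge (P-vertex p sel k hk) (P-vertex p sel k' hk') d
  along-P p sel d k hk k' hk' k+d≡k' inB = index-chain (P-vertex p sel) d k hk k' hk' k+d≡k'
    λ i hi hi' k≤i i+1≤k' → inB i hi k≤i (≤-trans (n≤1+n i) i+1≤k') ,
                             inB (suc i) hi' (≤-trans k≤i (n≤1+n i)) i+1≤k' , P-edge p sel i hi hi'

  along-Q : ∀ p q d r .(hr : r < c) r' .(hr' : r' < c) → r + d ≡ r' →
    Chain BoundaryEdge (Q-vertex p q r hr) (Q-vertex p q r' hr') d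
  along-Q p q d r hr r' hr' r+d≡r' =
    index-chain (Q-vertex p q) d r hr r' hr' r+d≡r' λ i hi hi' _ _ → tt , tt , Q-edge p q i hi hi'

  private
    v⁻<Psize : suc a < Psize
    v⁻<Psize = subst (suc a <_) (sym Psize≡1+top) (s≤s (s≤s (≤-trans (m≤m+n a a) (m≤n+m (a + a) 3))))

    v⁺<Psize : 3 + a < Psize
    v⁺<Psize =
      subst (3 + a <_) (sym Psize≡1+top) (s≤s (s≤s (s≤s (s≤s (≤-trans (m≤m+n a a) (n≤1+n (a + a)))))))

    reach-plain : ∀ p → s p ≡ plain → ∀ sel k h → Within BoundaryEdge top (y⁻ p sel) (P-vertex p sel k h)
    reach-plain p e sel k h =
      k , below-top h , along-P p sel k 0 0<Psize k h refl (λ i hi _ _ → P-vertex∈B-plain p e sel i hi)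

    reach-lower : ∀ p sel k .h → k ≤ suc a → Within BoundaryEdge (suc a) (y⁻ p sel) (P-vertex p sel k h)
    reach-lower p sel k h k≤a+1 = k , k≤a+1 , along-P p sel k 0 0<Psize k h refl
      (λ i hi _ i≤k → P-vertex∈B p sel i hi (λ i≡y → 1+n≰n (subst (_≤ suc a) i≡y (≤-trans i≤k k≤a+1))))

    reach-Q : ∀ p sel q r h → Within BoundaryEdge (suc a + (1 + suc a)) (y⁻ p sel) (Q-vertex p q r h)
    reach-Q p sel q r h = within-trans (reach-lower p sel (suc a) v⁻<Psize ≤-refl)
      (within-trans
        (within-step (P-vertex∈B p sel (suc a) v⁻<Psize (λ ()) , tt , v⁻-z⁻-edge p sel q v⁻<Psize (s≤s z≤n)))
                    (r , ≤-pred h , along-Q p q r 0 (s≤s z≤n) r h refl))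

    reach-upper : ∀ p sel → IsQ (s p) → ∀ k h → 3 + a ≤ k →
      Within BoundaryEdge ρ (y⁻ p sel) (P-vertex p sel k h)
    reach-upper p sel q k h v⁺≤k = within-trans (reach-Q p sel q (suc a) ≤-refl)
      (within-trans
        (within-step (tt , P-vertex∈B p sel (3 + a) v⁺<Psize (λ v⁺≡y → 1+n≰n (≤-reflexive v⁺≡y)) ,
                      z⁺-v⁺-edge p sel q v⁺<Psize ≤-refl))
        (k ∸ (3 + a) , k-v⁺≤a+1 ,
         along-P p sel (k ∸ (3 + a)) (3 + a) v⁺<Psize k h (m+[n∸m]≡n v⁺≤k)
           (λ i hi v⁺≤i _ → P-vertex∈B p sel i hi (λ i≡y → 1+n≰n (subst (3 + a ≤_) i≡y v⁺≤i)))))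
      where
      k-v⁺≤a+1 : k ∸ (3 + a) ≤ suc a
      k-v⁺≤a+1 = subst (k ∸ (3 + a) ≤_) (trans (cong (_∸ a) (sym (+-suc a a))) (m+n∸m≡n a (suc a)))
                   (∸-monoˡ-≤ (3 + a) (below-top h))

  y⁻-reaches-P : ∀ p sel k h → Bx (P-vertex p sel k h) →
    Within BoundaryEdge ρ (y⁻ p sel) (P-vertex p sel k h)
  y⁻-reaches-P p sel k h k∈B = go (s p) refl
    where
    go : ∀ σ → s p ≡ σ → Within BoundaryEdge ρ (y⁻ p sel) (P-vertex p sel k h)
    go none e = ⊥-elim (subst IsSel e sel)
    go plain e = within-mono (subst (top ≤_) (lemma a) (m≤m+n top (suc a))) (reach-plain p e sel k h)
      where
      lemma : ∀ a → 4 + (a + a) + suc a ≡ suc a + (1 + suc a) + (1 + suc a)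
      lemma = solve-∀
    go withQ e with k ≤? suc a
    ... | yes k≤a+1 = within-mono (≤-trans (m≤m+n _ _) (m≤m+n _ _)) (reach-lower p sel k h k≤a+1)
    ... | no k≰a+1 = reach-upper p sel (subst IsQ (sym e) tt) k h (≤∧≢⇒< (≰⇒> k≰a+1) k≢y)
      where
      k≢y : suc (suc a) ≢ k
      k≢y y≡k = subst (λ σ → InBP t σ (toℕ (fromℕ< h))) e k∈B (trans (toℕ-fromℕ< h) (sym y≡k))

  y⁻-reaches-Q : ∀ p sel q r h → Within BoundaryEdge ρ (y⁻ p sel) (Q-vertex p q r h)
  y⁻-reaches-Q p sel q r h = within-mono (m≤m+n _ _) (reach-Q p sel q r h)

  1≤Bd : 1 ≤ Bd
  1≤Bd = s≤s z≤n

  ρ+1≤Bd : ρ + 1 ≤ Bd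
  ρ+1≤Bd = subst (ρ + 1 ≤_) (lemma a) (m≤m+n (ρ + 1) 9)
    where
    lemma : ∀ a → suc a + (1 + suc a) + (1 + suc a) + 1 + 9 ≡ 3 * (5 + a)
    lemma = solve-∀

  ρ≤Bd : ρ ≤ Bd
  ρ≤Bd = ≤-trans (m≤m+n ρ 1) ρ+1≤Bd

  anchorAt : (p : Fin N) (σ : Status) → s p ≡ σ → X
  anchorAt p none _ = x-vertex p
  anchorAt p plain e = y⁻ p (subst IsSel (sym e) tt)
  anchorAt p withQ e = y⁻ p (subst IsSel (sym e) tt)

  anchor : Fin N → X
  anchor p = anchorAt p (s p) refl

  reaches-anchor-unselected : ∀ {n x} p → s p ≡ none → Within BoundaryEdge n x (x-vertex p) →
    Within BoundaryEdge n x (anchor p)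
  reaches-anchor-unselected {n} {x} p unselected w = go (s p) refl
    where
    go : ∀ σ (e : s p ≡ σ) → Within BoundaryEdge n x (anchorAt p σ e)
    go none _ = w
    go plain e with () ← trans (sym unselected) e
    go withQ e with () ← trans (sym unselected) e

  reaches-anchor-selected : ∀ {n x} p sel → Within BoundaryEdge n x (y⁻ p sel) →
    Within BoundaryEdge n x (anchor p)
  reaches-anchor-selected {n} {x} p sel w = go (s p) refl
    where
    go : ∀ σ (e : s p ≡ σ) → Within BoundaryEdge n x (anchorAt p σ e)
    go none e = ⊥-elim (subst IsSel e sel)
    go plain e = subst (Within BoundaryEdge n x ∘ y⁻ p) (IsSel-irrelevant sel _) w
    go withQ e = subst (Within BoundaryEdge n x ∘ y⁻ p) (IsSel-irrelevant sel _) w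

  anchor-step : ∀ p q → Succ N (toℕ p) (toℕ q) → Within BoundaryEdge Bd (anchor p) (anchor q)
  anchor-step p q pq = go (s p) refl (s q) refl
    where
    both-selected : ∀ {σ σ'} → s p ≡ σ → s q ≡ σ' → IsSel σ → IsSel σ' → ⊥
    both-selected e e' sel sel' = stable p q (inj₁ pq) (subst IsSel (sym e) sel) (subst IsSel (sym e') sel')
    top≢y : top ≢ suc (suc a)
    top≢y top≡y =
      1+n≰n (subst (3 + a ≤_) top≡y (s≤s (s≤s (s≤s (≤-trans (m≤m+n a a) (n≤1+n (a + a)))))))
    x→y⁻ : ∀ {sel} → s p ≡ none → Within BoundaryEdge Bd (x-vertex p) (y⁻ q sel)
    x→y⁻ {sel} unselected = within-mono 1≤Bd
      (within-step (x-vertex∈B p unselected , P-vertex∈B q sel 0 0<Psize (λ ()) , x⁻-y⁻-edge p q sel pq))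
    y⁻→x : ∀ {sel} → s q ≡ none → Within BoundaryEdge Bd (y⁻ p sel) (x-vertex q)
    y⁻→x {sel} unselected = within-mono ρ+1≤Bd
      (within-trans (y⁻-reaches-P p sel top top<Psize y⁺∈B)
                    (within-step (y⁺∈B , x-vertex∈B q unselected , y⁺-x⁺-edge p sel q pq)))
      where y⁺∈B = P-vertex∈B p sel top top<Psize top≢y
    go : ∀ σ (e : s p ≡ σ) σ' (e' : s q ≡ σ') → Within BoundaryEdge Bd (anchorAt p σ e) (anchorAt q σ' e')
    go none  e none  e' = within-mono 1≤Bd
      (within-step (x-vertex∈B p e , x-vertex∈B q e' , x-x-edge p q (inj₁ pq)))
    go none  e plain e' = x→y⁻ e
    go none  e withQ e' = x→y⁻ e
    go plain e none  e' = y⁻→x e'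
    go withQ e none  e' = y⁻→x e'
    go plain e plain e' = ⊥-elim (both-selected e e' tt tt)
    go plain e withQ e' = ⊥-elim (both-selected e e' tt tt)
    go withQ e plain e' = ⊥-elim (both-selected e e' tt tt)
    go withQ e withQ e' = ⊥-elim (both-selected e e' tt tt)

  anchor-chain : ∀ {i j k} → Chain (CycleStep N) i j k → (p q : Fin N) → toℕ p ≡ i → toℕ q ≡ j →
    Within BoundaryEdge (Bd * k) (anchor p) (anchor q)
  anchor-chain ε p q p≡i q≡i with toℕ-injective (trans p≡i (sym q≡i))
  ... | refl = within-refl
  anchor-chain {k = suc k} ((_ , i'<N , ii') ◅ w) p q p≡i q≡j =
    within-mono (≤-reflexive (sym (*-suc Bd k)))
      (within-trans (first-step ii') (anchor-chain w p' q (toℕ-fromℕ< i'<N) q≡j))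
    where
    p' = fromℕ< i'<N
    first-step : CycAdj N _ _ → Within BoundaryEdge Bd (anchor p) (anchor p')
    first-step (inj₁ pp') = anchor-step p p' (subst₂ (Succ N) (sym p≡i) (sym (toℕ-fromℕ< i'<N)) pp')
    first-step (inj₂ p'p) =
      within-sym BoundaryEdge-sym (anchor-step p' p (subst₂ (Succ N) (sym (toℕ-fromℕ< i'<N)) (sym p≡i) p'p))

  -- The vertex (ℓ , j) of B_ℓ lies above the position j (t-3)^(m-ℓ) of B_m; the vertices of
  -- P_p and Q_p lie above p.
  coord : X → ℕ
  coord (inj₁ (ℓ , j)) = toℕ j * c ^ (m ∸ toℕ ℓ)
  coord (inj₂ (inj₁ ((p , _) , _))) = toℕ p
  coord (inj₂ (inj₂ ((p , _) , _))) = toℕ p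

  depth : X → ℕ
  depth (inj₁ (ℓ , _)) = m ∸ toℕ ℓ
  depth (inj₂ _) = 0

  private
    level-vertex-≡ : ∀ (ℓ ℓ' : Fin (suc m)) (j : Fin (Len t (toℕ ℓ))) (j' : Fin (Len t (toℕ ℓ'))) →
      toℕ ℓ ≡ toℕ ℓ' → toℕ j ≡ toℕ j' → _≡_ {A = TV t m} (ℓ , j) (ℓ' , j')
    level-vertex-≡ ℓ ℓ' j j' ℓ≡ℓ' j≡j' with toℕ-injective ℓ≡ℓ'
    ... | refl = cong (ℓ ,_) (toℕ-injective j≡j')

  coord-top-level : ∀ (ℓ : Fin (suc m)) (j : Fin (Len t (toℕ ℓ))) → toℕ ℓ ≡ m → coord (inj₁ (ℓ , j)) ≡ toℕ j
  coord-top-level ℓ j ℓ≡m rewrite ℓ≡m | n∸n≡0 m = *-identityʳ (toℕ j)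

  depth-boundary : ∀ x → Bx x → depth x ≡ 0
  depth-boundary (inj₁ (ℓ , j)) (ℓ≡m , _) = trans (cong (m ∸_) ℓ≡m) (n∸n≡0 m)
  depth-boundary (inj₂ _) _ = refl

  near-anchor : ∀ x → Bx x → Σ (Fin N) λ p → toℕ p ≡ coord x × Within BoundaryEdge Bd x (anchor p)
  near-anchor (inj₁ (ℓ , j)) (ℓ≡m , p , p≡j , unselected) =
    p , trans p≡j (sym (coord-top-level ℓ j ℓ≡m)) ,
    reaches-anchor-unselected p unselected
      (subst (Within BoundaryEdge Bd (inj₁ (ℓ , j))) (cong inj₁ x≡xp) within-refl)
    where
    x≡xp : (ℓ , j) ≡ (fromℕ m , _)
    x≡xp = level-vertex-≡ ℓ (fromℕ m) j _
      (trans ℓ≡m (sym (toℕ-fromℕ m))) (trans (sym p≡j) (sym (toℕ-x-vertex p)))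
  near-anchor x@(inj₂ (inj₁ ((p , sel) , k))) k∈B =
    p , refl , reaches-anchor-selected p sel
      (within-sym BoundaryEdge-sym (within-mono ρ≤Bd
        (subst (Within BoundaryEdge ρ (y⁻ p sel)) (sym x≡)
          (y⁻-reaches-P p sel (toℕ k) (toℕ<n k) (subst Bx x≡ k∈B)))))
    where
    x≡ : x ≡ P-vertex p sel (toℕ k) (toℕ<n k)
    x≡ = cong (λ k → inj₂ (inj₁ ((p , sel) , k))) (sym (fromℕ<-toℕ k (toℕ<n k)))
  near-anchor x@(inj₂ (inj₂ ((p , q) , r))) _ =
    p , refl , reaches-anchor-selected p (IsQ⇒IsSel q)
      (within-sym BoundaryEdge-sym (within-mono ρ≤Bd
        (subst (Within BoundaryEdge ρ (y⁻ p _)) (sym x≡)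
          (y⁻-reaches-Q p (IsQ⇒IsSel q) q (toℕ r) (toℕ<n r)))))
    where
    x≡ : x ≡ Q-vertex p q (toℕ r) (toℕ<n r)
    x≡ = cong (λ r → inj₂ (inj₂ ((p , q) , r))) (sym (fromℕ<-toℕ r (toℕ<n r)))

  private
    ℓ≤m : (ℓ : Fin (suc m)) → toℕ ℓ ≤ m
    ℓ≤m ℓ = ≤-pred (toℕ<n ℓ)

    c^-suc : ∀ e → c ^ e ≡ suc (pred (c ^ e))
    c^-suc e = sym (suc-pred (c ^ e) {{>-nonZero (m^n>0 c e)}})

    Len*c^depth : ∀ l → l ≤ m → Len t l * c ^ (m ∸ l) ≡ N
    Len*c^depth l l≤m = begin
      t * c ^ l * c ^ (m ∸ l)   ≡⟨ *-assoc t (c ^ l) (c ^ (m ∸ l)) ⟩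
      t * (c ^ l * c ^ (m ∸ l)) ≡⟨ cong (t *_) (sym (^-distribˡ-+-* c l (m ∸ l))) ⟩
      t * c ^ (l + (m ∸ l))     ≡⟨ cong (λ e → t * c ^ e) (m+[n∸m]≡n l≤m) ⟩
      N                         ∎
      where open ≡-Reasoning

    coord-up : ∀ l {l'} J J' → suc l ≡ l' → l' ≤ m → J' ≡ J * c → J * c ^ (m ∸ l) ≡ J' * c ^ (m ∸ l')
    coord-up l J _ refl l'≤m refl rewrite +-∸-assoc 1 l'≤m = sym (*-assoc J c (c ^ (m ∸ suc l)))

    Succ-or-≡-near : ∀ i j → i < N → j < N → (Succ N i j) ⊎ (i ≡ j) ⊎ (Succ N j i) → Near 1 i j
    Succ-or-≡-near i j i<N j<N (inj₁ ij) = within-step (i<N , j<N , inj₁ ij)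
    Succ-or-≡-near i j i<N j<N (inj₂ (inj₁ refl)) = within-refl
    Succ-or-≡-near i j i<N j<N (inj₂ (inj₂ ji)) = within-step (i<N , j<N , inj₂ ji)

    TPAdj-positions : ∀ {A B C P Q R : Set} → (P × A) ⊎ (Q × B) ⊎ (R × C) → P ⊎ Q ⊎ R
    TPAdj-positions (inj₁ (x , _)) = inj₁ x
    TPAdj-positions (inj₂ (inj₁ (x , _))) = inj₂ (inj₁ x)
    TPAdj-positions (inj₂ (inj₂ (x , _))) = inj₂ (inj₂ x)

    x-P-near : ∀ (ℓ : Fin (suc m)) j p → toℕ ℓ ≡ m →
      (Succ N (toℕ j) (toℕ p)) ⊎ (toℕ j ≡ toℕ p) ⊎ (Succ N (toℕ p) (toℕ j)) →
      Near 1 (coord (inj₁ (ℓ , j))) (toℕ p)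
    x-P-near ℓ j p ℓ≡m jp = subst (λ i → Near 1 i (toℕ p)) (sym (coord-top-level ℓ j ℓ≡m))
      (Succ-or-≡-near (toℕ j) (toℕ p) (subst (toℕ j <_) (cong (Len t) ℓ≡m) (toℕ<n j)) (toℕ<n p) jp)

  edge-shift : ∀ x y → Ex x y → Near (c ^ depth x) (coord x) (coord y) × depth y ≤ suc (depth x)
  edge-shift (inj₁ (ℓ , j)) (inj₁ (ℓ' , j')) (inj₁ (ℓ≡ℓ' , jj')) =
    subst (λ l → Near _ _ (toℕ j' * c ^ (m ∸ l))) ℓ≡ℓ'
      (subst (λ C → Near C (toℕ j * C) (toℕ j' * C)) (sym (c^-suc (m ∸ toℕ ℓ)))
        (scaled-CycAdj-within (Len t (toℕ ℓ)) _ (toℕ j) (toℕ j')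
          (subst (λ C → Len t (toℕ ℓ) * C ≡ N) (c^-suc (m ∸ toℕ ℓ)) (Len*c^depth _ (ℓ≤m ℓ)))
          jj' (toℕ<n j) (subst (toℕ j' <_) (cong (Len t) (sym ℓ≡ℓ')) (toℕ<n j')))) ,
    ≤-trans (≤-reflexive (cong (m ∸_) (sym ℓ≡ℓ'))) (n≤1+n _)
  edge-shift (inj₁ (ℓ , j)) (inj₁ (ℓ' , j')) (inj₂ (inj₁ (ℓ+1≡ℓ' , j'≡jc))) =
    subst (Near _ _) (coord-up (toℕ ℓ) (toℕ j) (toℕ j') ℓ+1≡ℓ' (ℓ≤m ℓ') j'≡jc) within-refl ,
    ≤-trans (∸-monoʳ-≤ m (subst (toℕ ℓ ≤_) ℓ+1≡ℓ' (n≤1+n _))) (n≤1+n _)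
  edge-shift (inj₁ (ℓ , j)) (inj₁ (ℓ' , j')) (inj₂ (inj₂ (ℓ'+1≡ℓ , j≡j'c))) =
    subst (Near _ _) (sym (coord-up (toℕ ℓ') (toℕ j') (toℕ j) ℓ'+1≡ℓ (ℓ≤m ℓ) j≡j'c)) within-refl ,
    ≤-reflexive (trans (+-∸-assoc 1 (subst (_≤ m) (sym ℓ'+1≡ℓ) (ℓ≤m ℓ))) (cong (λ l → suc (m ∸ l)) ℓ'+1≡ℓ))
  edge-shift (inj₁ (ℓ , j)) (inj₂ (inj₁ ((p , _) , _))) (ℓ≡m , jp) =
    within-mono (m^n>0 c (m ∸ toℕ ℓ)) (x-P-near ℓ j p ℓ≡m (TPAdj-positions jp)) , z≤n
  edge-shift (inj₂ (inj₁ ((p , _) , _))) (inj₁ (ℓ , j)) (ℓ≡m , jp) =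
    within-sym CycleStep-sym (x-P-near ℓ j p ℓ≡m (TPAdj-positions jp)) ,
    ≤-trans (≤-reflexive (trans (cong (m ∸_) ℓ≡m) (n∸n≡0 m))) z≤n
  edge-shift (inj₂ (inj₁ _)) (inj₂ (inj₁ _)) (refl , _) = within-refl , z≤n
  edge-shift (inj₂ (inj₁ _)) (inj₂ (inj₂ _)) (refl , _) = within-refl , z≤n
  edge-shift (inj₂ (inj₂ _)) (inj₂ (inj₁ _)) (refl , _) = within-refl , z≤n
  edge-shift (inj₂ (inj₂ _)) (inj₂ (inj₂ _)) (refl , _) = within-refl , z≤n

  chain-shift : ∀ {x y l} → Chain Ex x y l → ∀ d → depth x ≤ d → Near (l * c ^ (d + l)) (coord x) (coord y)
  chain-shift ε _ _ = within-refl
  chain-shift {x} {l = suc l} (e ◅ w) d x≤d =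
    let near , depth-step = edge-shift x _ e in
    within-mono (+-mono-≤ (^-monoʳ-≤ c (≤-trans x≤d (m≤m+n d (suc l))))
                          (≤-reflexive (cong (λ k → l * c ^ k) (sym (+-suc d l)))))
      (within-trans near (chain-shift w (suc d) (≤-trans depth-step (s≤s x≤d))))

  detour : ℕ → ℕ
  detour l = Bd + (Bd * (l * c ^ l) + Bd)

  boundary-detour : ∀ {x y l} → Bx x → Bx y → Chain Ex x y l → Within BoundaryEdge (detour l) x y
  boundary-detour {x} {y} x∈B y∈B w =
    let p , p≡x , x→p = near-anchor x x∈B
        q , q≡y , y→q = near-anchor y y∈B
        k , k≤ , steps = chain-shift w 0 (≤-reflexive (depth-boundary x x∈B))
    in within-trans x→p (within-trans (within-mono (*-monoʳ-≤ Bd k≤) (anchor-chain steps p q p≡x q≡y))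
                                       (within-sym BoundaryEdge-sym y→q))

detour-below-girth : ∀ t l → 5 ≤ t → l ≤ t →
  2 + (3 * t + (3 * t * (l * (t ∸ 3) ^ l) + 3 * t)) ≤ t ^ (5 * t)
detour-below-girth t@(suc (suc (suc (suc (suc b))))) l (s≤s (s≤s (s≤s (s≤s (s≤s z≤n))))) l≤t = begin
  2 + (3 * t + (3 * t * R + 3 * t))
    ≤⟨ s≤s (s≤s (+-mono-≤ (m≤m*n (3 * t) T) (+-mono-≤ (*-monoʳ-≤ (3 * t) R≤T) (m≤m*n (3 * t) T)))) ⟩
  2 + (3 * t * T + (3 * t * T + 3 * t * T)) ≡⟨ cong (2 +_) (lemma₁ t T) ⟩
  2 + 9 * (t * T)                     ≤⟨ 2+9n≤11n (t * T) (m^n>0 t (2 + t)) ⟩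
  11 * (t * T)                        ≡⟨ sym (*-assoc 11 t T) ⟩
  11 * t * T                          ≤⟨ *-monoˡ-≤ T (11t≤t³ b) ⟩
  t ^ 3 * T                           ≡⟨ sym (^-distribˡ-+-* t 3 (suc t)) ⟩
  t ^ (4 + t)                         ≤⟨ ^-monoʳ-≤ t (4+t≤5t b) ⟩
  t ^ (5 * t)                         ∎
  where
  open ≤-Reasoning
  R T : ℕ
  R = l * (t ∸ 3) ^ l
  T = t ^ suc t
  instance
    T-nonZero : NonZero T
    T-nonZero = m^n≢0 t (suc t)
  R≤T : R ≤ T
  R≤T = *-mono-≤ l≤t (≤-trans (^-monoˡ-≤ l (m∸n≤m t 3)) (^-monoʳ-≤ t l≤t))
  lemma₁ : ∀ t T → 3 * t * T + (3 * t * T + 3 * t * T) ≡ 9 * (t * T)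
  lemma₁ = solve-∀
  2+9n≤11n : ∀ n → 0 < n → 2 + 9 * n ≤ 11 * n
  2+9n≤11n (suc n) _ = subst (2 + 9 * suc n ≤_) (lemma n) (m≤m+n _ (2 * n))
    where
    lemma : ∀ n → 2 + 9 * suc n + 2 * n ≡ 11 * suc n
    lemma = solve-∀
  11t≤t³ : ∀ b → 11 * (5 + b) ≤ (5 + b) ^ 3
  11t≤t³ b = subst (11 * (5 + b) ≤_) (lemma b) (m≤m+n _ ((5 + b) * (14 + 10 * b + b * b)))
    where
    lemma : ∀ b → 11 * (5 + b) + (5 + b) * (14 + 10 * b + b * b) ≡ (5 + b) * ((5 + b) * ((5 + b) * 1))
    lemma = solve-∀
  4+t≤5t : ∀ b → 4 + (5 + b) ≤ 5 * (5 + b)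
  4+t≤5t b = subst (4 + (5 + b) ≤_) (lemma b) (m≤m+n _ (16 + 4 * b))
    where
    lemma : ∀ b → 4 + (5 + b) + (16 + 4 * b) ≡ 5 * (5 + b)
    lemma = solve-∀

module Territory (a : ℕ) {W : Set} (D : GtData (5 + a) W) (K : GtData.𝒦 D)
  {m s} (stable : Stable (5 + a) m s) (φ : VIso (GtData.T D K) (XV (5 + a) m s) (XE (5 + a) m s))
  (boundary : ∀ w p → Iff (GtData.VK D K w) (InB (5 + a) m s (VIso.f φ w p))) where

  open GtData D
  open Expansion a m s stable
  open VIso φ
  open VIsoProperties φ

  K-vertex : ∀ x → Bx x → VK K (g x)
  K-vertex x x∈B = proj₂ (boundary (g x) (g-V x)) (subst Bx (sym (fg x (g-V x))) x∈B)

  boundary-edge⇒K-edge : ∀ {x y} → BoundaryEdge x y → E (ΓM (κ K)) (g x) (g y)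
  boundary-edge⇒K-edge {x} {y} (x∈B , y∈B , xy) =
    proj₂ (proj₂ (proj₁ (T-induced K (g x) (g y) (K-vertex x x∈B) (K-vertex y y∈B))
      (proj₂ (hom (g x) (g y) (g-V x) (g-V y)) (subst₂ Ex (sym (fg x (g-V x))) (sym (fg y (g-V y))) xy))))

  close-Γ-edge⇒K-edge : ∀ {u v l} → l ≤ 5 + a → Walk (T K) u v l → VK K u → VK K v →
    E Γ u v → E (ΓM (κ K)) u v
  close-Γ-edge⇒K-edge {u} {v} l≤t w u∈K v∈K uv =
    subst₂ (E (ΓM (κ K))) (gf u pu) (gf v pv) (boundary-edge⇒K-edge shortcut)
    where
    pu = T-K K u u∈K
    pv = T-K K v v∈K
    shortcut : BoundaryEdge (f u pu) (f v pv)
    shortcut = LoopErasure.short-detour⇒step BoundaryEdge _≟X_ Γ g g-injective (proj₁ ∘ boundary-edge⇒K-edge)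
      Γ-girth (detour-below-girth (5 + a) _ (s≤s (s≤s (s≤s (s≤s (s≤s z≤n))))) l≤t)
      (subst₂ (E Γ) (sym (gf u pu)) (sym (gf v pv)) uv)
      (boundary-detour (proj₁ (boundary u pu) u∈K) (proj₁ (boundary v pv) v∈K) (walk⇒chain w pu pv))

  close-Γ-edge⇒T-edge : ∀ {u v l} → l ≤ 5 + a → Walk (T K) u v l → V (T K) u → V (T K) v →
    E Γ u v → E (T K) u v
  close-Γ-edge⇒T-edge {u} {v} l≤t w pu pv uv =
    proj₂ (T-induced K u v u∈K v∈K) (u∈K , v∈K , close-Γ-edge⇒K-edge l≤t w u∈K v∈K uv)
    where
    u∈K = proj₁ (T-Γ K u) (pu , proj₁ (E-V Γ uv))
    v∈K = proj₁ (T-Γ K v) (pv , proj₂ (E-V Γ uv))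

  close-Gt-edge⇒T-edge : ∀ {u v l} → l ≤ 5 + a → Walk (T K) u v l → V (T K) u → V (T K) v →
    E Gt u v → E (T K) u v
  close-Gt-edge⇒T-edge l≤t w pu pv (inj₁ uv) = close-Γ-edge⇒T-edge l≤t w pu pv uv
  close-Gt-edge⇒T-edge {u} {v} l≤t w pu pv (inj₂ (K' , uv)) with Ex? (f u pu) (f v pv)
  ... | yes xy = proj₂ (hom u v pu pv) xy
  ... | no ¬xy = ⊥-elim (¬xy (proj₁ (hom u v pu pv) (close-Γ-edge⇒T-edge l≤t w pu pv Γ-edge)))
    where
    -- Equality in 𝒦 is undecidable, so we decide adjacency in T_K instead.  If it fails then
    -- K ≠ K', so u and v lie on K', an induced cycle of T_K', and uv is an edge of Γ.
    K≢K' : K ≢ K'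
    K≢K' K≡K' = ¬xy (proj₁ (hom u v pu pv) (subst (λ k → E (T k) u v) (sym K≡K') uv))
    u∈K' = proj₂ (proj₁ (T-disj K K' K≢K' u) (pu , proj₁ (E-V (T K') uv)))
    v∈K' = proj₂ (proj₁ (T-disj K K' K≢K' v) (pv , proj₂ (E-V (T K') uv)))
    Γ-edge : E Γ u v
    Γ-edge = proj₁ (proj₂ (proj₂ (proj₁ (T-induced K' u v u∈K' v∈K') uv)))

lemma6p2 : (t : ℕ) → 5 ≤ t → {W : Set} (D : GtData t W) →
    (K : GtData.𝒦 D) (H : Graph W) →
    InducedSubgraph H (GtData.T D K) → Connected H → DistAtMost H (t ∸ 1) →
    InducedSubgraph H (GtData.Gt D)
lemma6p2 (suc (suc (suc (suc (suc a))))) (s≤s (s≤s (s≤s (s≤s (s≤s z≤n))))) D K H H⊆T _ close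
  with GtData.T-canon D K
... | _ , _ , stable , φ , boundary = (λ w w∈H → inj₂ (K , proj₁ H⊆T w w∈H)) , adjacency
  where
  open Territory a D K stable φ boundary
  adjacency : ∀ u v → V H u → V H v → Iff (E H u v) (E (GtData.Gt D) u v)
  adjacency u v u∈H v∈H =
    (λ uv → inj₂ (K , proj₁ (proj₂ H⊆T u v u∈H v∈H) uv)) ,
    (λ uv → let l , l≤t-1 , w = close u v u∈H v∈H in
      proj₂ (proj₂ H⊆T u v u∈H v∈H)
        (close-Gt-edge⇒T-edge (m≤n⇒m≤1+n l≤t-1) (subgraph-walk H⊆T w)
          (proj₁ H⊆T u u∈H) (proj₁ H⊆T v v∈H) uv))
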